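{- Let $d\geq2$, let $A$ be a $d\times(d-1)$ matrix with integer entries such that $A^tA$ is non-singular, and let $b\in\mathbb{Z}^d$. Consider the $d\times d$ integer matrix $(A,b)$ whose rows are formed by a row of $A$ followed by the corresponding coordinate of $b$. Let $(\overline{A},\overline{b})$ be obtained from $(A,b)$ by dividing each row by the greatest common divisor of its coordinates (zero rows being left unchanged) and then negating an arbitrary subset of the resulting rows, where $\overline{A}$ consists of the first $d-1$ columns and $\overline{b}$ of the last column. Then $$\bigl\|A(A^tA)^{ -1}A^tb-b\bigr\|\geq\bigl\|\overline{A}(\overline{A}^t\overline{A})^{ -1}\overline{A}^t\overline{b}-\overline{b}\bigr\|,$$ and the two sides of this inequality are either both zero or both positive.
   Context: $\|\cdot\|$ denotes the Euclidean norm. (Note that $\overline{A}=DA$ for an invertible diagonal matrix $D$, so $\overline{A}^t\overline{A}$ is non-singular.) -}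

module Defs where

open import Data.Bool using (Bool; true; false)
open import Data.Nat as ℕ using (ℕ; zero; suc)
open import Data.Fin using (Fin; zero; suc; punchIn; toℕ; inject₁; fromℕ)
open import Data.Integer as ℤ using (ℤ)
open import Data.Integer.DivMod using (_/ℕ_)
open import Data.Nat.GCD using (gcd)
open import Data.Rational as ℚ using (ℚ; 0ℚ; 1ℚ; _+_; _*_; -_; _-_; 1/_; _/_)
open import Data.Rational.Properties using (_≟_)
open import Relation.Nullary using (yes; no)
open import Relation.Binary.PropositionalEquality using (_≢_)

Mat : Set → ℕ → ℕ → Set
Mat X m n = Fin m → Fin n → X

sumF : ∀ {n} → (Fin n → ℚ) → ℚ
sumF {zero} f = 0ℚ
sumF {suc n} f = f zero + sumF (λ i → f (suc i))

infix 9 _ᵀ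
infixl 7 _⊗_
infixr 6 _·_
_ᵀ : ∀ {m n} → Mat ℚ m n → Mat ℚ n m
(M ᵀ) i j = M j i

_⊗_ : ∀ {m n p} → Mat ℚ m n → Mat ℚ n p → Mat ℚ m p
(M ⊗ N) i k = sumF (λ j → M i j * N j k)

_·_ : ∀ {m n} → Mat ℚ m n → (Fin n → ℚ) → (Fin m → ℚ)
(M · v) i = sumF (λ j → M i j * v j)

sign : ℕ → ℚ
sign zero = 1ℚ
sign (suc zero) = - 1ℚ
sign (suc (suc k)) = sign k

minor : ∀ {n} → Fin (suc n) → Fin (suc n) → Mat ℚ (suc n) (suc n) → Mat ℚ n n
minor i j M k l = M (punchIn i k) (punchIn j l)

det : ∀ {n} → Mat ℚ n n → ℚ
det {zero} M = 1ℚ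
det {suc n} M = sumF (λ j → sign (toℕ j) * (M zero j * det (minor zero j M)))

adj : ∀ {n} → Mat ℚ n n → Mat ℚ n n
adj {suc n} M i j = sign (toℕ i ℕ.+ toℕ j) * det (minor j i M)

-- Matrix inverse adj(M)/det(M) (the zero matrix if M is singular; only
-- used for non-singular M).
inv : ∀ {n} → Mat ℚ n n → Mat ℚ n n
inv M with det M ≟ 0ℚ
... | yes _ = λ _ _ → 0ℚ
... | no ne = λ i j → (1/ det M) {{ℚ.≢-nonZero ne}} * adj M i j

normSq : ∀ {m} → (Fin m → ℚ) → ℚ
normSq v = sumF (λ i → v i * v i)

toℚM : ∀ {m n} → Mat ℤ m n → Mat ℚ m n
toℚM A i j = A i j / 1

toℚV : ∀ {m} → (Fin m → ℤ) → Fin m → ℚ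
toℚV b i = b i / 1

residual : ∀ {m n} → Mat ℤ m n → (Fin m → ℤ) → Fin m → ℚ
residual A b i =
  ((Aq ⊗ inv (Aq ᵀ ⊗ Aq)) · ((Aq ᵀ) · bq)) i - bq i
  where
  Aq = toℚM A
  bq = toℚV b

snoc : ∀ {n} {X : Set} → (Fin n → X) → X → Fin (suc n) → X
snoc {zero} r x zero = x
snoc {suc n} r x zero = r zero
snoc {suc n} r x (suc j) = snoc (λ k → r (suc k)) x j

-- The d×d matrix (A,b) (here d = m, and A has n columns).
augment : ∀ {m n} → Mat ℤ m n → (Fin m → ℤ) → Mat ℤ m (suc n)
augment A b i = snoc (A i) (b i)

-- gcd of the coordinates of an integer vector (a natural number;
-- it is 0 exactly for the zero vector).
gcdV : ∀ {n} → (Fin n → ℤ) → ℕ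
gcdV {zero} v = 0
gcdV {suc n} v = gcd ℤ.∣ v zero ∣ (gcdV (λ i → v (suc i)))

primitiveV : ∀ {n} → (Fin n → ℤ) → Fin n → ℤ
primitiveV v with gcdV v
... | zero = v
... | suc g = λ j → v j /ℕ suc g

negIf : ∀ {n} → Bool → (Fin n → ℤ) → Fin n → ℤ
negIf true v j = ℤ.- v j
negIf false v j = v j

reduced : ∀ {m n} → Mat ℤ m n → (Fin m → ℤ) → (Fin m → Bool) → Mat ℤ m (suc n)
reduced A b s i = negIf (s i) (primitiveV (augment A b i))

Abar : ∀ {m n} → Mat ℤ m n → (Fin m → ℤ) → (Fin m → Bool) → Mat ℤ m n
Abar A b s i j = reduced A b s i (inject₁ j)

bbar : ∀ {m n} → Mat ℤ m n → (Fin m → ℤ) → (Fin m → Bool) → Fin m → ℤ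
bbar {n = n} A b s i = reduced A b s i (fromℕ n)

module Submission where

-- Over ℚ, every row of (A, b) is a nonzero integer multiple μᵢ of the corresponding
-- row of (Ā, b̄): A = DĀ and b = Db̄ with D = diag(μ) and |μᵢ| ≥ 1.  The vector
-- A(AᵗA)⁻¹Aᵗb − b is the least-squares residual r, the shortest vector of the form
-- Ax − b.  So for the least-squares solution y of (A, b),
--   ‖r̄‖ ≤ ‖Āy − b̄‖ ≤ ‖D(Āy − b̄)‖ = ‖r‖,
-- and if r̄ = 0 then Aȳ − b = Dr̄ = 0 for the solution ȳ of (Ā, b̄), so r = 0.
-- ĀᵗĀ is non-singular because Ā inherits the trivial kernel of A, and a Gram
-- matrix with trivial kernel is an anisotropic form, whose determinant cannot vanish.

open import Data.Bool using (Bool; true; false)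
open import Data.Empty using (⊥-elim)
open import Data.Fin using (Fin; zero; suc; punchIn; toℕ; inject₁; fromℕ)
open import Data.Fin.Properties using (punchInᵢ≢i)
open import Data.Integer as ℤ using (ℤ)
import Data.Integer.Properties as ℤ
open import Data.Integer.DivMod using (_/ℕ_; a≡a%ℕn+[a/ℕn]*n)
open import Data.Nat as ℕ using (ℕ; zero; suc)
import Data.Nat.Properties as ℕ
open import Data.Nat.Coprimality as Coprimality using (1-coprimeTo)
open import Data.Nat.Divisibility using (_∣_; ∣-trans; n∣m⇒m%n≡0)
open import Data.Nat.GCD using (gcd[m,n]∣m; gcd[m,n]∣n)
open import Data.Product using (∃; _×_; _,_; proj₁; proj₂)
open import Data.Rational using (ℚ; 0ℚ; 1ℚ; _+_; _*_; -_; _-_; _≤_; _<_; _/_; 1/_; mkℚ; *≤*; ≢-nonZero; nonNegative)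
open import Data.Rational.Properties
open import Algebra.Bundles using (CommutativeMonoid)
open import Algebra.Properties.CommutativeSemigroup (CommutativeMonoid.commutativeSemigroup *-1-commutativeMonoid)
  using () renaming (x∙yz≈y∙xz to x*yz≡y*xz)
open import Data.Sum using (_⊎_; inj₁; inj₂)
open import Data.Vec.Functional using (updateAt)
open import Data.Vec.Functional.Properties using (updateAt-updates; updateAt-minimal; updateAt-id-local)
open import Function using (const)
open import Relation.Binary.Definitions using (tri<; tri≈; tri>)
open import Relation.Binary.PropositionalEquality
open import Relation.Nullary using (yes; no)
open import Relation.Nullary.Decidable using (dec⇒maybe)
open import Tactic.RingSolver using (solve-∀)
open import Tactic.RingSolver.Core.AlmostCommutativeRing using (AlmostCommutativeRing; fromCommutativeRing)

open import Defs

ℚ-ring : AlmostCommutativeRing _ _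
ℚ-ring = fromCommutativeRing +-*-commutativeRing (λ x → dec⇒maybe (0ℚ ≟ x))

sumF-cong : ∀ {n} {f g : Fin n → ℚ} → (∀ i → f i ≡ g i) → sumF f ≡ sumF g
sumF-cong {zero}  f≡g = refl
sumF-cong {suc n} f≡g = cong₂ _+_ (f≡g zero) (sumF-cong (λ i → f≡g (suc i)))

sumF-zero : ∀ {n} {f : Fin n → ℚ} → (∀ i → f i ≡ 0ℚ) → sumF f ≡ 0ℚ
sumF-zero {zero}  f≡0 = refl
sumF-zero {suc n} f≡0 = cong₂ _+_ (f≡0 zero) (sumF-zero (λ i → f≡0 (suc i)))

sumF-+ : ∀ {n} (f g : Fin n → ℚ) → sumF (λ i → f i + g i) ≡ sumF f + sumF g
sumF-+ {zero}  f g = refl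
sumF-+ {suc n} f g = trans (cong (f zero + g zero +_) (sumF-+ (λ i → f (suc i)) (λ i → g (suc i))))
                           (interchange (f zero) (g zero) _ _)
  where
  interchange : ∀ a b c d → (a + b) + (c + d) ≡ (a + c) + (b + d)
  interchange = solve-∀ ℚ-ring

sumF-*ˡ : ∀ {n} (c : ℚ) (f : Fin n → ℚ) → sumF (λ i → c * f i) ≡ c * sumF f
sumF-*ˡ {zero}  c f = sym (*-zeroʳ c)
sumF-*ˡ {suc n} c f = trans (cong (c * f zero +_) (sumF-*ˡ c (λ i → f (suc i))))
                            (sym (*-distribˡ-+ c (f zero) _))

sumF-*ʳ : ∀ {n} (c : ℚ) (f : Fin n → ℚ) → sumF (λ i → f i * c) ≡ sumF f * c
sumF-*ʳ c f = trans (sumF-cong (λ i → *-comm (f i) c)) (trans (sumF-*ˡ c f) (*-comm c (sumF f)))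

sumF-sub : ∀ {n} (f g : Fin n → ℚ) → sumF (λ i → f i - g i) ≡ sumF f - sumF g
sumF-sub f g = begin
  sumF (λ i → f i - g i)             ≡⟨ sumF-cong (λ i → cong (f i +_) (neg≡-1* (g i))) ⟩
  sumF (λ i → f i + - 1ℚ * g i)      ≡⟨ sumF-+ f _ ⟩
  sumF f + sumF (λ i → - 1ℚ * g i)   ≡⟨ cong (sumF f +_) (sumF-*ˡ (- 1ℚ) g) ⟩
  sumF f + - 1ℚ * sumF g             ≡⟨ cong (sumF f +_) (sym (neg≡-1* (sumF g))) ⟩
  sumF f - sumF g                    ∎
  where
  open ≡-Reasoning
  neg≡-1* : ∀ a → - a ≡ - 1ℚ * a
  neg≡-1* = solve-∀ ℚ-ring

sumF-swap : ∀ {m n} (f : Fin m → Fin n → ℚ) →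
            sumF (λ i → sumF (λ j → f i j)) ≡ sumF (λ j → sumF (λ i → f i j))
sumF-swap {zero} {n} f = sym (sumF-zero {n} (λ _ → refl))
sumF-swap {suc m} f = trans (cong (sumF (f zero) +_) (sumF-swap (λ i → f (suc i))))
                            (sym (sumF-+ (f zero) _))

sumF-punchIn : ∀ {n} (f : Fin (suc n) → ℚ) (a : Fin (suc n)) →
               sumF (λ l → f (punchIn a l)) ≡ sumF f - f a
sumF-punchIn f zero = cancel (f zero) _
  where
  cancel : ∀ a s → s ≡ (a + s) - a
  cancel = solve-∀ ℚ-ring
sumF-punchIn {suc n} f (suc a) =
  trans (cong (f zero +_) (sumF-punchIn (λ i → f (suc i)) a)) (reassoc (f zero) _ _)
  where
  reassoc : ∀ x s y → x + (s - y) ≡ (x + s) - y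
  reassoc = solve-∀ ℚ-ring

sumF-single : ∀ {n} (f : Fin (suc n) → ℚ) (a : Fin (suc n)) →
              (∀ b → b ≢ a → f b ≡ 0ℚ) → sumF f ≡ f a
sumF-single f a f≡0 = begin
  sumF f                             ≡⟨ split (sumF f) (f a) ⟩
  (sumF f - f a) + f a               ≡⟨ cong (_+ f a) (sym (sumF-punchIn f a)) ⟩
  sumF (λ l → f (punchIn a l)) + f a ≡⟨ cong (_+ f a) (sumF-zero (λ l → f≡0 _ (punchInᵢ≢i a l))) ⟩
  0ℚ + f a                           ≡⟨ +-identityˡ (f a) ⟩
  f a                                ∎
  where
  open ≡-Reasoning
  split : ∀ s x → s ≡ (s - x) + x
  split = solve-∀ ℚ-ring

-- Both sides are the sum of F over the pairs (a, b) with a ≢ b.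
sumF-offDiagonal-swap : ∀ {n} (F : Fin (suc n) → Fin (suc n) → ℚ) →
  sumF (λ a → sumF (λ l → F a (punchIn a l))) ≡ sumF (λ b → sumF (λ l → F (punchIn b l) b))
sumF-offDiagonal-swap F = begin
  sumF (λ a → sumF (λ l → F a (punchIn a l)))          ≡⟨ sumF-cong (λ a → sumF-punchIn (F a) a) ⟩
  sumF (λ a → sumF (F a) - F a a)                      ≡⟨ sumF-sub (λ a → sumF (F a)) (λ a → F a a) ⟩
  sumF (λ a → sumF (F a)) - sumF (λ a → F a a)         ≡⟨ cong (_- sumF (λ a → F a a)) (sumF-swap F) ⟩
  sumF (λ b → sumF (λ a → F a b)) - sumF (λ b → F b b) ≡⟨ sumF-sub (λ b → sumF (λ a → F a b)) (λ b → F b b) ⟨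
  sumF (λ b → sumF (λ a → F a b) - F b b)              ≡⟨ sumF-cong (λ b → sumF-punchIn (λ a → F a b) b) ⟨
  sumF (λ b → sumF (λ l → F (punchIn b l) b))          ∎
  where open ≡-Reasoning

-- Laplace expansion along an arbitrary row

sign-suc : ∀ x → sign (suc x) ≡ - sign x
sign-suc zero          = refl
sign-suc (suc zero)    = refl
sign-suc (suc (suc x)) = sign-suc x

sign-+ : ∀ x y → sign (x ℕ.+ y) ≡ sign x * sign y
sign-+ zero          y = sym (*-identityˡ (sign y))
sign-+ (suc zero)    y = trans (sign-suc y) (neg≡-1* (sign y))
  where
  neg≡-1* : ∀ a → - a ≡ - 1ℚ * a
  neg≡-1* = solve-∀ ℚ-ring
sign-+ (suc (suc x)) y = sign-+ x y

-- punchOut without the proof of distinctness; punchOut′ a a is junk.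
punchOut′ : ∀ {n} → Fin (suc (suc n)) → Fin (suc (suc n)) → Fin (suc n)
punchOut′           zero    zero    = zero
punchOut′           zero    (suc b) = b
punchOut′           (suc a) zero    = zero
punchOut′ {suc n}   (suc a) (suc b) = suc (punchOut′ a b)
punchOut′ {zero}    (suc a) (suc b) = zero

punchOut′-punchIn : ∀ {n} (a : Fin (suc (suc n))) (l : Fin (suc n)) → punchOut′ a (punchIn a l) ≡ l
punchOut′-punchIn zero            l       = refl
punchOut′-punchIn (suc a)         zero    = refl
punchOut′-punchIn {suc n} (suc a) (suc l) = cong suc (punchOut′-punchIn a l)

punchIn-punchOut′ : ∀ {n} {a b : Fin (suc (suc n))} → a ≢ b → punchIn a (punchOut′ a b) ≡ b
punchIn-punchOut′ {a = zero}  {zero}  a≢b = ⊥-elim (a≢b refl)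
punchIn-punchOut′ {a = zero}  {suc b} a≢b = refl
punchIn-punchOut′ {a = suc a} {zero}  a≢b = refl
punchIn-punchOut′ {suc n} {suc a} {suc b} a≢b = cong suc (punchIn-punchOut′ (λ a≡b → a≢b (cong suc a≡b)))
punchIn-punchOut′ {zero}  {suc zero} {suc zero} a≢b = ⊥-elim (a≢b refl)

-- Deleting a and then b leaves the same columns as deleting b and then a.
punchIn-punchOut′-swap : ∀ {n} {a b : Fin (suc (suc n))} → a ≢ b → (c : Fin n) →
  punchIn a (punchIn (punchOut′ a b) c) ≡ punchIn b (punchIn (punchOut′ b a) c)
punchIn-punchOut′-swap {a = zero}  {zero}  a≢b c = ⊥-elim (a≢b refl)
punchIn-punchOut′-swap {a = zero}  {suc b} a≢b c = refl
punchIn-punchOut′-swap {a = suc a} {zero}  a≢b c = refl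
punchIn-punchOut′-swap {suc n} {suc a} {suc b} a≢b zero    = refl
punchIn-punchOut′-swap {suc n} {suc a} {suc b} a≢b (suc c) =
  cong suc (punchIn-punchOut′-swap (λ a≡b → a≢b (cong suc a≡b)) c)

sign-punchOut′ : ∀ {n} {a b : Fin (suc (suc n))} → a ≢ b →
  sign (toℕ a ℕ.+ toℕ (punchOut′ a b)) ≡ - sign (toℕ b ℕ.+ toℕ (punchOut′ b a))
sign-punchOut′ {a = zero}  {zero}  a≢b = ⊥-elim (a≢b refl)
sign-punchOut′ {a = zero}  {suc b} a≢b = begin
  sign (toℕ b)                   ≡⟨ neg-neg (sign (toℕ b)) ⟩
  - - sign (toℕ b)               ≡⟨ cong -_ (sym (sign-suc (toℕ b))) ⟩
  - sign (suc (toℕ b))           ≡⟨ cong (λ x → - sign (suc x)) (sym (ℕ.+-identityʳ (toℕ b))) ⟩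
  - sign (suc (toℕ b ℕ.+ 0))     ∎
  where
  open ≡-Reasoning
  neg-neg : ∀ x → x ≡ - - x
  neg-neg = solve-∀ ℚ-ring
sign-punchOut′ {a = suc a} {zero}  a≢b =
  trans (cong (λ x → sign (suc x)) (ℕ.+-identityʳ (toℕ a))) (sign-suc (toℕ a))
sign-punchOut′ {suc n} {suc a} {suc b} a≢b = begin
  sign (suc (toℕ a ℕ.+ suc (toℕ (punchOut′ a b))))  ≡⟨ cong sign (cong suc (ℕ.+-suc (toℕ a) _)) ⟩
  sign (toℕ a ℕ.+ toℕ (punchOut′ a b))              ≡⟨ sign-punchOut′ (λ a≡b → a≢b (cong suc a≡b)) ⟩
  - sign (toℕ b ℕ.+ toℕ (punchOut′ b a))            ≡⟨ cong (λ x → - sign x) (cong suc (ℕ.+-suc (toℕ b) _)) ⟨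
  - sign (suc (toℕ b ℕ.+ suc (toℕ (punchOut′ b a)))) ∎
  where open ≡-Reasoning
sign-punchOut′ {zero} {suc zero} {suc zero} a≢b = ⊥-elim (a≢b refl)

det-cong : ∀ {n} {M N : Mat ℚ n n} → (∀ i j → M i j ≡ N i j) → det M ≡ det N
det-cong {zero}  M≡N = refl
det-cong {suc n} M≡N = sumF-cong (λ j →
  cong₂ (λ x d → sign (toℕ j) * (x * d)) (M≡N zero j) (det-cong (λ r c → M≡N (punchIn zero r) (punchIn j c))))

-- The terms of det M expanded along row 0 and then row suc k (zeroFirst),
-- or in the opposite order (sucFirst).
module LaplaceTerms {n} (k : Fin (suc n)) (M : Mat ℚ (suc (suc n)) (suc (suc n))) where

  doubleMinor : Fin (suc (suc n)) → Fin (suc n) → ℚ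
  doubleMinor a l = det (λ r c → M (suc (punchIn k r)) (punchIn a (punchIn l c)))

  zeroFirst : Fin (suc (suc n)) → Fin (suc n) → ℚ
  zeroFirst a l =
    sign (toℕ a) * (M zero a * (sign (toℕ k ℕ.+ toℕ l) * (M (suc k) (punchIn a l) * doubleMinor a l)))

  sucFirst : Fin (suc (suc n)) → Fin (suc n) → ℚ
  sucFirst b m =
    sign (suc (toℕ k ℕ.+ toℕ b)) * (M (suc k) b * (sign (toℕ m) * (M zero (punchIn b m) * doubleMinor b m)))

  private
    signs : ∀ {a b : Fin (suc (suc n))} → a ≢ b →
      sign (toℕ a) * sign (toℕ k ℕ.+ toℕ (punchOut′ a b))
        ≡ sign (suc (toℕ k ℕ.+ toℕ b)) * sign (toℕ (punchOut′ b a))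
    signs {a} {b} a≢b = begin
      sign (toℕ a) * sign (toℕ k ℕ.+ toℕ (punchOut′ a b))
        ≡⟨ cong (sign (toℕ a) *_) (sign-+ (toℕ k) (toℕ (punchOut′ a b))) ⟩
      sign (toℕ a) * (sign (toℕ k) * sign (toℕ (punchOut′ a b)))
        ≡⟨ x*yz≡y*xz (sign (toℕ a)) (sign (toℕ k)) _ ⟩
      sign (toℕ k) * (sign (toℕ a) * sign (toℕ (punchOut′ a b)))
        ≡⟨ cong (sign (toℕ k) *_) (sign-+ (toℕ a) _) ⟨
      sign (toℕ k) * sign (toℕ a ℕ.+ toℕ (punchOut′ a b))
        ≡⟨ cong (λ x → sign (toℕ k) * x) (trans (sign-punchOut′ a≢b) (cong -_ (sign-+ (toℕ b) _))) ⟩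
      sign (toℕ k) * - (sign (toℕ b) * sign (toℕ (punchOut′ b a)))
        ≡⟨ neg-regroup (sign (toℕ k)) (sign (toℕ b)) _ ⟩
      - (sign (toℕ k) * sign (toℕ b)) * sign (toℕ (punchOut′ b a))
        ≡⟨ cong (_* sign (toℕ (punchOut′ b a)))
                (trans (sign-suc (toℕ k ℕ.+ toℕ b)) (cong -_ (sign-+ (toℕ k) (toℕ b)))) ⟨
      sign (suc (toℕ k ℕ.+ toℕ b)) * sign (toℕ (punchOut′ b a)) ∎
      where
      open ≡-Reasoning
      neg-regroup : ∀ x y z → x * - (y * z) ≡ - (x * y) * z
      neg-regroup = solve-∀ ℚ-ring

    regroup : ∀ s t s′ t′ x y d → s * t ≡ s′ * t′ → s * (x * (t * (y * d))) ≡ s′ * (y * (t′ * (x * d)))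
    regroup s t s′ t′ x y d st≡s′t′ = begin
      s * (x * (t * (y * d)))   ≡⟨ pull s t x y d ⟩
      (s * t) * (x * (y * d))   ≡⟨ cong (_* (x * (y * d))) st≡s′t′ ⟩
      (s′ * t′) * (x * (y * d)) ≡⟨ pull′ s′ t′ x y d ⟩
      s′ * (y * (t′ * (x * d))) ∎
      where
      open ≡-Reasoning
      pull : ∀ s t x y d → s * (x * (t * (y * d))) ≡ (s * t) * (x * (y * d))
      pull = solve-∀ ℚ-ring
      pull′ : ∀ s t x y d → (s * t) * (x * (y * d)) ≡ s * (y * (t * (x * d)))
      pull′ = solve-∀ ℚ-ring

  zeroFirst≡sucFirst : ∀ {a b : Fin (suc (suc n))} → a ≢ b → zeroFirst a (punchOut′ a b) ≡ sucFirst b (punchOut′ b a)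
  zeroFirst≡sucFirst {a} {b} a≢b = begin
    zeroFirst a (punchOut′ a b)
      ≡⟨ cong (λ c → sign (toℕ a) * (M zero a * (sign (toℕ k ℕ.+ toℕ (punchOut′ a b)) * (M (suc k) c * D))))
              (punchIn-punchOut′ a≢b) ⟩
    sign (toℕ a) * (M zero a * (sign (toℕ k ℕ.+ toℕ (punchOut′ a b)) * (M (suc k) b * D)))
      ≡⟨ regroup (sign (toℕ a)) (sign (toℕ k ℕ.+ toℕ (punchOut′ a b)))
                 (sign (suc (toℕ k ℕ.+ toℕ b))) (sign (toℕ (punchOut′ b a)))
                 (M zero a) (M (suc k) b) D (signs a≢b) ⟩
    sign (suc (toℕ k ℕ.+ toℕ b)) * (M (suc k) b * (sign (toℕ (punchOut′ b a)) * (M zero a * D)))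
      ≡⟨ cong₂ (λ c d → sign (suc (toℕ k ℕ.+ toℕ b)) * (M (suc k) b * (sign (toℕ (punchOut′ b a)) * (M zero c * d))))
               (sym (punchIn-punchOut′ (λ b≡a → a≢b (sym b≡a))))
               (det-cong (λ r c → cong (M (suc (punchIn k r))) (punchIn-punchOut′-swap a≢b c))) ⟩
    sucFirst b (punchOut′ b a) ∎
    where
    open ≡-Reasoning
    D = doubleMinor a (punchOut′ a b)

det-expandRow : ∀ {n} (k : Fin (suc n)) (M : Mat ℚ (suc n) (suc n)) →
  det M ≡ sumF (λ j → sign (toℕ k ℕ.+ toℕ j) * (M k j * det (minor k j M)))
det-expandRow zero M = refl
det-expandRow {suc n} (suc k) M = begin
  det M
    ≡⟨ sumF-cong (λ a → trans (cong (λ d → sign (toℕ a) * (M zero a * d)) (det-expandRow k (minor zero a M)))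
                              (*-*-sumF (sign (toℕ a)) (M zero a) (minor₀-expansion a))) ⟩
  sumF (λ a → sumF (zeroFirst a))
    ≡⟨ sumF-cong (λ a → sumF-cong (λ l → cong (zeroFirst a) (punchOut′-punchIn a l))) ⟨
  sumF (λ a → sumF (λ l → zeroFirst a (punchOut′ a (punchIn a l))))
    ≡⟨ sumF-offDiagonal-swap (λ a b → zeroFirst a (punchOut′ a b)) ⟩
  sumF (λ b → sumF (λ l → zeroFirst (punchIn b l) (punchOut′ (punchIn b l) b)))
    ≡⟨ sumF-cong (λ b → sumF-cong (λ l → trans (zeroFirst≡sucFirst (punchInᵢ≢i b l))
                                              (cong (sucFirst b) (punchOut′-punchIn b l)))) ⟩
  sumF (λ b → sumF (sucFirst b))
    ≡⟨ sumF-cong (λ b → *-*-sumF (sign (suc (toℕ k ℕ.+ toℕ b))) (M (suc k) b) (minorₖ-expansion b)) ⟨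
  sumF (λ b → sign (suc (toℕ k ℕ.+ toℕ b)) * (M (suc k) b * det (minor (suc k) b M))) ∎
  where
  open ≡-Reasoning
  open LaplaceTerms k M
  minor₀-expansion : Fin (suc (suc n)) → Fin (suc n) → ℚ
  minor₀-expansion a l = sign (toℕ k ℕ.+ toℕ l) * (M (suc k) (punchIn a l) * doubleMinor a l)
  minorₖ-expansion : Fin (suc (suc n)) → Fin (suc n) → ℚ
  minorₖ-expansion b m = sign (toℕ m) * (M zero (punchIn b m) * doubleMinor b m)
  *-*-sumF : ∀ {m} s x (f : Fin m → ℚ) → s * (x * sumF f) ≡ sumF (λ l → s * (x * f l))
  *-*-sumF s x f = trans (cong (s *_) (sym (sumF-*ˡ x f))) (sym (sumF-*ˡ s (λ l → x * f l)))

-- Determinants with a repeated row, and the adjugate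

det-2×2 : (M : Mat ℚ 2 2) → det M ≡ M zero zero * M (suc zero) (suc zero) - M zero (suc zero) * M (suc zero) zero
det-2×2 M = expand (M zero zero) (M zero (suc zero)) (M (suc zero) zero) (M (suc zero) (suc zero))
  where
  expand : ∀ a b c d →
    1ℚ * (a * (1ℚ * (d * 1ℚ) + 0ℚ)) + (- 1ℚ * (b * (1ℚ * (c * 1ℚ) + 0ℚ)) + 0ℚ) ≡ a * d - b * c
  expand = solve-∀ ℚ-ring

avoid₂ : ∀ {n} (p q : Fin (suc (suc (suc n)))) → ∃ λ r → r ≢ p × r ≢ q
avoid₂ zero          zero          = suc zero , (λ ()) , (λ ())
avoid₂ zero          (suc zero)    = suc (suc zero) , (λ ()) , (λ ())
avoid₂ zero          (suc (suc q)) = suc zero , (λ ()) , (λ ())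
avoid₂ (suc zero)    zero          = suc (suc zero) , (λ ()) , (λ ())
avoid₂ (suc zero)    (suc q)       = zero , (λ ()) , (λ ())
avoid₂ (suc (suc p)) zero          = suc zero , (λ ()) , (λ ())
avoid₂ (suc (suc p)) (suc q)       = zero , (λ ()) , (λ ())

-- For n ≥ 3, expanding along a third row reduces to minors with a repeated row.
det-repeatedRow : ∀ {n} (M : Mat ℚ n n) {p q : Fin n} → p ≢ q → (∀ j → M p j ≡ M q j) → det M ≡ 0ℚ
det-repeatedRow {suc zero} M {zero} {zero} p≢q Mp≡Mq = ⊥-elim (p≢q refl)
det-repeatedRow {suc (suc zero)} M {zero}     {zero}     p≢q Mp≡Mq = ⊥-elim (p≢q refl)
det-repeatedRow {suc (suc zero)} M {suc zero} {suc zero} p≢q Mp≡Mq = ⊥-elim (p≢q refl)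
det-repeatedRow {suc (suc zero)} M {zero}     {suc zero} p≢q Mp≡Mq =
  trans (det-2×2 M)
        (trans (cong₂ (λ x y → M zero zero * x - M zero (suc zero) * y) (sym (Mp≡Mq (suc zero))) (sym (Mp≡Mq zero)))
               (a*b-b*a≡0 (M zero zero) (M zero (suc zero))))
  where
  a*b-b*a≡0 : ∀ a b → a * b - b * a ≡ 0ℚ
  a*b-b*a≡0 = solve-∀ ℚ-ring
det-repeatedRow {suc (suc zero)} M {suc zero} {zero} p≢q Mp≡Mq =
  det-repeatedRow M (λ q≡p → p≢q (sym q≡p)) (λ j → sym (Mp≡Mq j))
det-repeatedRow {suc (suc (suc n))} M {p} {q} p≢q Mp≡Mq =
  trans (det-expandRow r M)
        (sumF-zero (λ j → expansionTerm-vanishes j (det-repeatedRow (minor r j M) p′≢q′ (repeated j))))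
  where
  r   = proj₁ (avoid₂ p q)
  r≢p = proj₁ (proj₂ (avoid₂ p q))
  r≢q = proj₂ (proj₂ (avoid₂ p q))
  p′ = punchOut′ r p
  q′ = punchOut′ r q
  p′≢q′ : p′ ≢ q′
  p′≢q′ p′≡q′ =
    p≢q (trans (sym (punchIn-punchOut′ r≢p)) (trans (cong (punchIn r) p′≡q′) (punchIn-punchOut′ r≢q)))
  repeated : ∀ j c → minor r j M p′ c ≡ minor r j M q′ c
  repeated j c = begin
    M (punchIn r p′) (punchIn j c) ≡⟨ cong (λ i → M i (punchIn j c)) (punchIn-punchOut′ r≢p) ⟩
    M p (punchIn j c)              ≡⟨ Mp≡Mq (punchIn j c) ⟩
    M q (punchIn j c)              ≡⟨ cong (λ i → M i (punchIn j c)) (punchIn-punchOut′ r≢q) ⟨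
    M (punchIn r q′) (punchIn j c) ∎
    where open ≡-Reasoning
  expansionTerm-vanishes : ∀ j → det (minor r j M) ≡ 0ℚ → sign (toℕ r ℕ.+ toℕ j) * (M r j * det (minor r j M)) ≡ 0ℚ
  expansionTerm-vanishes j d≡0 = begin
    sign (toℕ r ℕ.+ toℕ j) * (M r j * det (minor r j M)) ≡⟨ cong (λ d → σ * (M r j * d)) d≡0 ⟩
    σ * (M r j * 0ℚ)                                     ≡⟨ cong (σ *_) (*-zeroʳ (M r j)) ⟩
    σ * 0ℚ                                               ≡⟨ *-zeroʳ σ ⟩
    0ℚ                                                   ∎
    where
    open ≡-Reasoning
    σ = sign (toℕ r ℕ.+ toℕ j)

⊗-adj≡det-updateAt : ∀ {n} (N : Mat ℚ (suc n) (suc n)) (i k : Fin (suc n)) →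
  (N ⊗ adj N) i k ≡ det (updateAt N k (const (N i)))
⊗-adj≡det-updateAt N i k = sym (trans (det-expandRow k N′) (sumF-cong term))
  where
  N′ = updateAt N k (const (N i))
  term : ∀ j → sign (toℕ k ℕ.+ toℕ j) * (N′ k j * det (minor k j N′))
               ≡ N i j * (sign (toℕ j ℕ.+ toℕ k) * det (minor k j N))
  term j = begin
    sign (toℕ k ℕ.+ toℕ j) * (N′ k j * det (minor k j N′))
      ≡⟨ cong₂ (λ x d → sign (toℕ k ℕ.+ toℕ j) * (x * d))
               (cong-app (updateAt-updates k N) j)
               (det-cong (λ r c → cong-app (updateAt-minimal (punchIn k r) k N (punchInᵢ≢i k r)) (punchIn j c))) ⟩
    sign (toℕ k ℕ.+ toℕ j) * (N i j * det (minor k j N))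
      ≡⟨ cong (λ s → s * (N i j * det (minor k j N))) (cong sign (ℕ.+-comm (toℕ k) (toℕ j))) ⟩
    sign (toℕ j ℕ.+ toℕ k) * (N i j * det (minor k j N))
      ≡⟨ x*yz≡y*xz (sign (toℕ j ℕ.+ toℕ k)) (N i j) _ ⟩
    N i j * (sign (toℕ j ℕ.+ toℕ k) * det (minor k j N)) ∎
    where open ≡-Reasoning

⊗-adj-diagonal : ∀ {n} (N : Mat ℚ (suc n) (suc n)) k → (N ⊗ adj N) k k ≡ det N
⊗-adj-diagonal N k = trans (⊗-adj≡det-updateAt N k k) (det-cong (λ r → cong-app (updateAt-id-local k N refl r)))

⊗-adj-offDiagonal : ∀ {n} (N : Mat ℚ (suc n) (suc n)) {i k} → i ≢ k → (N ⊗ adj N) i k ≡ 0ℚ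
⊗-adj-offDiagonal N {i} {k} i≢k = trans (⊗-adj≡det-updateAt N i k)
  (det-repeatedRow (updateAt N k (const (N i))) i≢k
    (λ j → trans (cong-app (updateAt-minimal i k N i≢k) j) (sym (cong-app (updateAt-updates k N) j))))

infix 8 _∙_
_∙_ : ∀ {n} → (Fin n → ℚ) → (Fin n → ℚ) → ℚ
u ∙ v = sumF (λ i → u i * v i)

⊗-·-assoc : ∀ {m n p} (X : Mat ℚ m n) (Y : Mat ℚ n p) (w : Fin p → ℚ) i →
            ((X ⊗ Y) · w) i ≡ (X · (Y · w)) i
⊗-·-assoc X Y w i = begin
  sumF (λ j → sumF (λ l → X i l * Y l j) * w j)   ≡⟨ sumF-cong (λ j → sumF-*ʳ (w j) (λ l → X i l * Y l j)) ⟨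
  sumF (λ j → sumF (λ l → X i l * Y l j * w j))   ≡⟨ sumF-swap (λ j l → X i l * Y l j * w j) ⟩
  sumF (λ l → sumF (λ j → X i l * Y l j * w j))
    ≡⟨ sumF-cong (λ l → trans (sumF-cong (λ j → *-assoc (X i l) (Y l j) (w j))) (sumF-*ˡ (X i l) (λ j → Y l j * w j))) ⟩
  sumF (λ l → X i l * sumF (λ j → Y l j * w j))   ∎
  where open ≡-Reasoning

∙-·-transpose : ∀ {m n} (M : Mat ℚ m n) (u : Fin m → ℚ) (z : Fin n → ℚ) → u ∙ (M · z) ≡ (M ᵀ · u) ∙ z
∙-·-transpose M u z = begin
  sumF (λ i → u i * sumF (λ j → M i j * z j))    ≡⟨ sumF-cong (λ i → sumF-*ˡ (u i) (λ j → M i j * z j)) ⟨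
  sumF (λ i → sumF (λ j → u i * (M i j * z j)))  ≡⟨ sumF-swap (λ i j → u i * (M i j * z j)) ⟩
  sumF (λ j → sumF (λ i → u i * (M i j * z j)))
    ≡⟨ sumF-cong (λ j → trans (sumF-cong (λ i → regroup (u i) (M i j) (z j)))
                              (sumF-*ʳ (z j) (λ i → M i j * u i))) ⟩
  sumF (λ j → sumF (λ i → M i j * u i) * z j)    ∎
  where
  open ≡-Reasoning
  regroup : ∀ u m z → u * (m * z) ≡ m * u * z
  regroup = solve-∀ ℚ-ring

·-distrib-sub : ∀ {m n} (M : Mat ℚ m n) (x y : Fin n → ℚ) i → (M · (λ j → x j - y j)) i ≡ (M · x) i - (M · y) i
·-distrib-sub M x y i = trans (sumF-cong (λ j → distrib (M i j) (x j) (y j))) (sumF-sub (λ j → M i j * x j) (λ j → M i j * y j))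
  where
  distrib : ∀ m x y → m * (x - y) ≡ m * x - m * y
  distrib = solve-∀ ℚ-ring

inv-inverseʳ : ∀ {n} (N : Mat ℚ (suc n) (suc n)) → det N ≢ 0ℚ → ∀ w i → (N · (inv N · w)) i ≡ w i
inv-inverseʳ N det≢0 w i with det N ≟ 0ℚ
... | yes det≡0 = ⊥-elim (det≢0 det≡0)
... | no det≢0′ = begin
  (N · (P · w)) i                        ≡⟨ ⊗-·-assoc N P w i ⟨
  sumF (λ j → (N ⊗ P) i j * w j)         ≡⟨ sumF-cong (λ j → cong (_* w j) (⊗-scaled j)) ⟩
  sumF (λ j → c * (N ⊗ adj N) i j * w j) ≡⟨ sumF-single _ i offDiagonal ⟩
  c * (N ⊗ adj N) i i * w i              ≡⟨ cong (λ x → c * x * w i) (⊗-adj-diagonal N i) ⟩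
  c * det N * w i                        ≡⟨ cong (_* w i) (*-inverseˡ (det N) {{≢-nonZero det≢0′}}) ⟩
  1ℚ * w i                               ≡⟨ *-identityˡ (w i) ⟩
  w i                                    ∎
  where
  open ≡-Reasoning
  c = (1/ det N) {{≢-nonZero det≢0′}}
  P : Mat ℚ (suc _) (suc _)
  P k l = c * adj N k l
  ⊗-scaled : ∀ j → (N ⊗ P) i j ≡ c * (N ⊗ adj N) i j
  ⊗-scaled j = trans (sumF-cong (λ l → x*yz≡y*xz (N i l) c (adj N l j))) (sumF-*ˡ c (λ l → N i l * adj N l j))
  offDiagonal : ∀ j → j ≢ i → c * (N ⊗ adj N) i j * w j ≡ 0ℚ
  offDiagonal j j≢i = begin
    c * (N ⊗ adj N) i j * w j ≡⟨ cong (λ x → c * x * w j) (⊗-adj-offDiagonal N (λ i≡j → j≢i (sym i≡j))) ⟩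
    c * 0ℚ * w j              ≡⟨ cong (_* w j) (*-zeroʳ c) ⟩
    0ℚ * w j                  ≡⟨ *-zeroˡ (w j) ⟩
    0ℚ                        ∎

square-nonNeg : ∀ x → 0ℚ ≤ x * x
square-nonNeg x with ≤-total 0ℚ x
... | inj₁ 0≤x = let instance _ = nonNegative 0≤x in nonNegative⁻¹ _ {{nonNeg*nonNeg⇒nonNeg x x}}
... | inj₂ x≤0 = let instance _ = nonNegative (neg-antimono-≤ x≤0) in
  subst (0ℚ ≤_) (neg*neg x) (nonNegative⁻¹ _ {{nonNeg*nonNeg⇒nonNeg (- x) (- x)}})
  where
  neg*neg : ∀ x → - x * - x ≡ x * x
  neg*neg = solve-∀ ℚ-ring

square≡0⇒≡0 : ∀ x → x * x ≡ 0ℚ → x ≡ 0ℚ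
square≡0⇒≡0 x x²≡0 with x ≟ 0ℚ
... | yes x≡0 = x≡0
... | no  x≢0 = begin
  x                 ≡⟨ *-identityʳ x ⟨
  x * 1ℚ            ≡⟨ cong (x *_) (*-inverseʳ x) ⟨
  x * (x * x⁻¹)     ≡⟨ *-assoc x x x⁻¹ ⟨
  (x * x) * x⁻¹     ≡⟨ cong (_* x⁻¹) x²≡0 ⟩
  0ℚ * x⁻¹          ≡⟨ *-zeroˡ x⁻¹ ⟩
  0ℚ                ∎
  where
  open ≡-Reasoning
  instance _ = ≢-nonZero x≢0
  x⁻¹ = 1/ x

nonNeg∧≢0⇒pos : ∀ {x} → 0ℚ ≤ x → x ≢ 0ℚ → 0ℚ < x
nonNeg∧≢0⇒pos {x} 0≤x x≢0 with <-cmp 0ℚ x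
... | tri< 0<x _ _ = 0<x
... | tri≈ _ 0≡x _ = ⊥-elim (x≢0 (sym 0≡x))
... | tri> _ _ x<0 = ⊥-elim (<-irrefl refl (<-≤-trans x<0 0≤x))

sumF-nonNeg : ∀ {n} {f : Fin n → ℚ} → (∀ i → 0ℚ ≤ f i) → 0ℚ ≤ sumF f
sumF-nonNeg {zero}  f≥0 = ≤-refl
sumF-nonNeg {suc n} f≥0 = +-mono-≤ (f≥0 zero) (sumF-nonNeg (λ i → f≥0 (suc i)))

sumF-mono-≤ : ∀ {n} {f g : Fin n → ℚ} → (∀ i → f i ≤ g i) → sumF f ≤ sumF g
sumF-mono-≤ {zero}  f≤g = ≤-refl
sumF-mono-≤ {suc n} f≤g = +-mono-≤ (f≤g zero) (sumF-mono-≤ (λ i → f≤g (suc i)))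

sumF-nonNeg≡0⇒≡0 : ∀ {n} {f : Fin n → ℚ} → (∀ i → 0ℚ ≤ f i) → sumF f ≡ 0ℚ → ∀ i → f i ≡ 0ℚ
sumF-nonNeg≡0⇒≡0 {suc n} {f} f≥0 sum≡0 = λ
  { zero    → ≤-antisym (subst (f zero ≤_) sum≡0 head≤sum) (f≥0 zero)
  ; (suc i) → sumF-nonNeg≡0⇒≡0 (λ i → f≥0 (suc i))
                (≤-antisym (subst (tail ≤_) sum≡0 tail≤sum) (sumF-nonNeg (λ i → f≥0 (suc i)))) i
  }
  where
  tail = sumF (λ i → f (suc i))
  head≤sum : f zero ≤ f zero + tail
  head≤sum = subst (_≤ f zero + tail) (+-identityʳ (f zero)) (+-monoʳ-≤ (f zero) (sumF-nonNeg (λ i → f≥0 (suc i))))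
  tail≤sum : tail ≤ f zero + tail
  tail≤sum = subst (_≤ f zero + tail) (+-identityˡ tail) (+-monoˡ-≤ tail (f≥0 zero))

normSq-cong : ∀ {n} {u v : Fin n → ℚ} → (∀ i → u i ≡ v i) → normSq u ≡ normSq v
normSq-cong u≡v = sumF-cong (λ i → cong₂ _*_ (u≡v i) (u≡v i))

normSq-nonNeg : ∀ {n} (v : Fin n → ℚ) → 0ℚ ≤ normSq v
normSq-nonNeg v = sumF-nonNeg (λ i → square-nonNeg (v i))

normSq≡0⇒≡0 : ∀ {n} (v : Fin n → ℚ) → normSq v ≡ 0ℚ → ∀ i → v i ≡ 0ℚ
normSq≡0⇒≡0 v ‖v‖²≡0 i = square≡0⇒≡0 (v i) (sumF-nonNeg≡0⇒≡0 (λ i → square-nonNeg (v i)) ‖v‖²≡0 i)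

-- Least squares

residualAt : ∀ {m n} → Mat ℚ m n → (Fin m → ℚ) → (Fin n → ℚ) → Fin m → ℚ
residualAt M c x i = (M · x) i - c i

lsSolution : ∀ {m n} → Mat ℚ m n → (Fin m → ℚ) → Fin n → ℚ
lsSolution M c = inv (M ᵀ ⊗ M) · (M ᵀ · c)

-- residual A b in Defs is lsResidual (toℚM A) (toℚV b) by unfolding.
lsResidual : ∀ {m n} → Mat ℚ m n → (Fin m → ℚ) → Fin m → ℚ
lsResidual M c i = ((M ⊗ inv (M ᵀ ⊗ M)) · (M ᵀ · c)) i - c i

lsResidual≡residualAt : ∀ {m n} (M : Mat ℚ m n) (c : Fin m → ℚ) i →
                        lsResidual M c i ≡ residualAt M c (lsSolution M c) i
lsResidual≡residualAt M c i = cong (_- c i) (⊗-·-assoc M (inv (M ᵀ ⊗ M)) (M ᵀ · c) i)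

lsResidual-orthogonal : ∀ {m n} (M : Mat ℚ m (suc n)) (c : Fin m → ℚ) → det (M ᵀ ⊗ M) ≢ 0ℚ →
                        ∀ j → (M ᵀ · lsResidual M c) j ≡ 0ℚ
lsResidual-orthogonal M c det≢0 j = begin
  sumF (λ i → M i j * lsResidual M c i)
    ≡⟨ sumF-cong (λ i → trans (cong (M i j *_) (lsResidual≡residualAt M c i)) (distrib (M i j) _ (c i))) ⟩
  sumF (λ i → M i j * (M · y) i - M i j * c i)  ≡⟨ sumF-sub (λ i → M i j * (M · y) i) (λ i → M i j * c i) ⟩
  (M ᵀ · (M · y)) j - (M ᵀ · c) j               ≡⟨ cong (_- (M ᵀ · c) j) (⊗-·-assoc (M ᵀ) M y j) ⟨
  ((M ᵀ ⊗ M) · y) j - (M ᵀ · c) j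
    ≡⟨ cong (_- (M ᵀ · c) j) (inv-inverseʳ (M ᵀ ⊗ M) det≢0 (M ᵀ · c) j) ⟩
  (M ᵀ · c) j - (M ᵀ · c) j                     ≡⟨ +-inverseʳ ((M ᵀ · c) j) ⟩
  0ℚ                                            ∎
  where
  open ≡-Reasoning
  y = lsSolution M c
  distrib : ∀ m x y → m * (x - y) ≡ m * x - m * y
  distrib = solve-∀ ℚ-ring

normSq-+-orthogonal : ∀ {n} (u v : Fin n → ℚ) → u ∙ v ≡ 0ℚ → normSq (λ i → u i + v i) ≡ normSq u + normSq v
normSq-+-orthogonal u v u∙v≡0 = begin
  sumF (λ i → (u i + v i) * (u i + v i))
    ≡⟨ sumF-cong (λ i → expand (u i) (v i)) ⟩
  sumF (λ i → (u i * u i + v i * v i) + 2ℚ * (u i * v i))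
    ≡⟨ sumF-+ (λ i → u i * u i + v i * v i) (λ i → 2ℚ * (u i * v i)) ⟩
  sumF (λ i → u i * u i + v i * v i) + sumF (λ i → 2ℚ * (u i * v i))
    ≡⟨ cong₂ _+_ (sumF-+ (λ i → u i * u i) (λ i → v i * v i))
                 (trans (sumF-*ˡ 2ℚ (λ i → u i * v i)) (trans (cong (2ℚ *_) u∙v≡0) (*-zeroʳ 2ℚ))) ⟩
  (normSq u + normSq v) + 0ℚ
    ≡⟨ +-identityʳ (normSq u + normSq v) ⟩
  normSq u + normSq v ∎
  where
  open ≡-Reasoning
  2ℚ = 1ℚ + 1ℚ
  expand : ∀ a b → (a + b) * (a + b) ≡ (a * a + b * b) + (1ℚ + 1ℚ) * (a * b)
  expand = solve-∀ ℚ-ring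

-- Pythagoras: Mx - c is the residual plus M(x - y), which is orthogonal to it.
lsResidual-minimal : ∀ {m n} (M : Mat ℚ m (suc n)) (c : Fin m → ℚ) → det (M ᵀ ⊗ M) ≢ 0ℚ →
                     ∀ x → normSq (lsResidual M c) ≤ normSq (residualAt M c x)
lsResidual-minimal M c det≢0 x = begin
  normSq r                       ≡⟨ +-identityʳ (normSq r) ⟨
  normSq r + 0ℚ                  ≤⟨ +-monoʳ-≤ (normSq r) (normSq-nonNeg t) ⟩
  normSq r + normSq t            ≡⟨ normSq-+-orthogonal r t r∙t≡0 ⟨
  normSq (λ i → r i + t i)       ≡⟨ normSq-cong split ⟨
  normSq (residualAt M c x)      ∎
  where
  open ≤-Reasoning
  r = lsResidual M c
  y = lsSolution M c
  z = λ j → x j - y j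
  t = M · z
  r∙t≡0 : r ∙ t ≡ 0ℚ
  r∙t≡0 = trans (∙-·-transpose M r z)
                (sumF-zero (λ j → trans (cong (_* z j) (lsResidual-orthogonal M c det≢0 j)) (*-zeroˡ (z j))))
  split : ∀ i → residualAt M c x i ≡ r i + t i
  split i = trans (telescope ((M · x) i) ((M · y) i) (c i))
                  (cong₂ _+_ (sym (lsResidual≡residualAt M c i)) (sym (·-distrib-sub M x y i)))
    where
    telescope : ∀ a b c → a - c ≡ (b - c) + (a - b)
    telescope = solve-∀ ℚ-ring

-- Anisotropic forms and Gram matrices

Anisotropic : ∀ {n} → Mat ℚ n n → Set
Anisotropic N = ∀ x → x ∙ (N · x) ≡ 0ℚ → ∀ i → x i ≡ 0ℚ

TrivialKernel : ∀ {m n} → Mat ℚ m n → Set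
TrivialKernel M = ∀ x → (∀ i → (M · x) i ≡ 0ℚ) → ∀ j → x j ≡ 0ℚ

anisotropic-minor : ∀ {n} (N : Mat ℚ (suc (suc n)) (suc (suc n))) → Anisotropic N → Anisotropic (minor zero zero N)
anisotropic-minor N aniso x x∙N′x≡0 i = aniso y y∙Ny≡0 (suc i)
  where
  y : Fin _ → ℚ
  y zero    = 0ℚ
  y (suc j) = x j
  N′x = minor zero zero N · x
  y∙Ny≡0 : y ∙ (N · y) ≡ 0ℚ
  y∙Ny≡0 = begin
    0ℚ * (N · y) zero + sumF (λ i → x i * (N (suc i) zero * 0ℚ + N′x i))
      ≡⟨ cong₂ _+_ (*-zeroˡ ((N · y) zero))
                   (sumF-cong (λ i → cong (λ a → x i * (a + N′x i)) (*-zeroʳ (N (suc i) zero)))) ⟩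
    0ℚ + sumF (λ i → x i * (0ℚ + N′x i))
      ≡⟨ +-identityˡ _ ⟩
    sumF (λ i → x i * (0ℚ + N′x i))
      ≡⟨ sumF-cong (λ i → cong (x i *_) (+-identityˡ (N′x i))) ⟩
    x ∙ N′x
      ≡⟨ x∙N′x≡0 ⟩
    0ℚ ∎
    where open ≡-Reasoning

anisotropic⇒det≢0 : ∀ {n} (N : Mat ℚ (suc n) (suc n)) → Anisotropic N → det N ≢ 0ℚ
anisotropic⇒det-minor≢0 : ∀ {n} (N : Mat ℚ (suc n) (suc n)) → Anisotropic N → det (minor zero zero N) ≢ 0ℚ

-- If det N = 0, the first column of adj N lies in the kernel of N, so its
-- first entry, the leading principal minor, vanishes.
anisotropic⇒det≢0 N aniso det≡0 = anisotropic⇒det-minor≢0 N aniso (trans (sym (*-identityˡ _)) adj₀₀≡0)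
  where
  C : Fin _ → ℚ
  C j = adj N j zero
  NC≡0 : ∀ i → (N · C) i ≡ 0ℚ
  NC≡0 zero    = trans (⊗-adj-diagonal N zero) det≡0
  NC≡0 (suc i) = ⊗-adj-offDiagonal N (λ ())
  adj₀₀≡0 : C zero ≡ 0ℚ
  adj₀₀≡0 = aniso C (sumF-zero (λ i → trans (cong (C i *_) (NC≡0 i)) (*-zeroʳ (C i)))) zero

anisotropic⇒det-minor≢0 {zero}  N aniso = 1≢0
anisotropic⇒det-minor≢0 {suc n} N aniso = anisotropic⇒det≢0 (minor zero zero N) (anisotropic-minor N aniso)

gram-symmetric : ∀ {m n} (M : Mat ℚ m n) i j → (M ᵀ ⊗ M) i j ≡ (M ᵀ ⊗ M) j i
gram-symmetric M i j = sumF-cong (λ k → *-comm (M k i) (M k j))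

gram-quadratic : ∀ {m n} (M : Mat ℚ m n) x → x ∙ ((M ᵀ ⊗ M) · x) ≡ normSq (M · x)
gram-quadratic M x = trans (sumF-cong (λ i → cong (x i *_) (⊗-·-assoc (M ᵀ) M x i))) (∙-·-transpose (M ᵀ) x (M · x))

gram-anisotropic : ∀ {m n} (M : Mat ℚ m n) → TrivialKernel M → Anisotropic (M ᵀ ⊗ M)
gram-anisotropic M ker x x∙Nx≡0 = ker x (normSq≡0⇒≡0 (M · x) (trans (sym (gram-quadratic M x)) x∙Nx≡0))

-- ‖x‖² = x ∙ N (N⁻¹ x) = (N x) ∙ (N⁻¹ x) for the symmetric N = MᵀM.
gram-det≢0⇒trivialKernel : ∀ {m n} (M : Mat ℚ m (suc n)) → det (M ᵀ ⊗ M) ≢ 0ℚ → TrivialKernel M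
gram-det≢0⇒trivialKernel M det≢0 x Mx≡0 = normSq≡0⇒≡0 x (begin
  x ∙ x                      ≡⟨ sumF-cong (λ i → cong (x i *_) (inv-inverseʳ N det≢0 x i)) ⟨
  x ∙ (N · (inv N · x))      ≡⟨ ∙-·-transpose N x (inv N · x) ⟩
  (N ᵀ · x) ∙ (inv N · x)
    ≡⟨ sumF-zero (λ j → trans (cong (_* (inv N · x) j) (Nᵀx≡0 j)) (*-zeroˡ ((inv N · x) j))) ⟩
  0ℚ                         ∎)
  where
  open ≡-Reasoning
  N = M ᵀ ⊗ M
  Nᵀx≡0 : ∀ j → (N ᵀ · x) j ≡ 0ℚ
  Nᵀx≡0 j = begin
    (N ᵀ · x) j         ≡⟨ sumF-cong (λ l → cong (_* x l) (gram-symmetric M l j)) ⟩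
    (N · x) j           ≡⟨ ⊗-·-assoc (M ᵀ) M x j ⟩
    (M ᵀ · (M · x)) j   ≡⟨ sumF-zero (λ k → trans (cong (M k j *_) (Mx≡0 k)) (*-zeroʳ (M k j))) ⟩
    0ℚ                  ∎

-- Rows of (A, b) are integer multiples of the reduced rows

snoc-inject₁ : ∀ {n} {X : Set} (r : Fin n → X) (x : X) j → snoc r x (inject₁ j) ≡ r j
snoc-inject₁ {suc n} r x zero    = refl
snoc-inject₁ {suc n} r x (suc j) = snoc-inject₁ (λ k → r (suc k)) x j

snoc-fromℕ : ∀ {n} {X : Set} (r : Fin n → X) (x : X) → snoc r x (fromℕ n) ≡ x
snoc-fromℕ {zero}  r x = refl
snoc-fromℕ {suc n} r x = snoc-fromℕ (λ k → r (suc k)) x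

/1≡mkℚ : ∀ i → i / 1 ≡ mkℚ i 0 (Coprimality.sym (1-coprimeTo ℤ.∣ i ∣))
/1≡mkℚ (ℤ.+ n)    = normalize-coprime (Coprimality.sym (1-coprimeTo n))
/1≡mkℚ ℤ.-[1+ n ] = cong -_ (normalize-coprime (Coprimality.sym (1-coprimeTo (suc n))))

/1-* : ∀ x y → (x ℤ.* y) / 1 ≡ (x / 1) * (y / 1)
/1-* x y rewrite /1≡mkℚ x | /1≡mkℚ y = refl

1≤+[1+n]/1 : ∀ n → 1ℚ ≤ ℤ.+ suc n / 1
1≤+[1+n]/1 n rewrite /1≡mkℚ (ℤ.+ suc n) = *≤* (ℤ.+≤+ (ℕ.s≤s ℕ.z≤n))

1≤square : ∀ μ → μ ≢ ℤ.0ℤ → 1ℚ ≤ (μ / 1) * (μ / 1)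
1≤square (ℤ.+ zero)  μ≢0 = ⊥-elim (μ≢0 refl)
1≤square μ@(ℤ.+ suc g) _ = subst (1ℚ ≤_) (/1-* μ μ) (1≤+[1+n]/1 (g ℕ.+ g ℕ.* suc g))
1≤square μ@(ℤ.-[1+ g ]) _ = subst (1ℚ ≤_) (/1-* μ μ) (1≤+[1+n]/1 (g ℕ.+ g ℕ.* suc g))

gcdV-∣ : ∀ {n} (v : Fin n → ℤ) j → gcdV v ∣ ℤ.∣ v j ∣
gcdV-∣ {suc n} v zero    = gcd[m,n]∣m ℤ.∣ v zero ∣ (gcdV (λ i → v (suc i)))
gcdV-∣ {suc n} v (suc j) = ∣-trans (gcd[m,n]∣n ℤ.∣ v zero ∣ (gcdV (λ i → v (suc i)))) (gcdV-∣ (λ i → v (suc i)) j)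

∣⇒%ℕ≡0 : ∀ a g → suc g ∣ ℤ.∣ a ∣ → a ℤ.%ℕ suc g ≡ 0
∣⇒%ℕ≡0 (ℤ.+ n)    g g∣a = n∣m⇒m%n≡0 n (suc g) g∣a
∣⇒%ℕ≡0 ℤ.-[1+ n ] g g∣a with suc n ℕ.% suc g | n∣m⇒m%n≡0 (suc n) (suc g) g∣a
... | zero | _ = refl

∣⇒≡*/ℕ : ∀ a g → suc g ∣ ℤ.∣ a ∣ → a ≡ ℤ.+ suc g ℤ.* (a /ℕ suc g)
∣⇒≡*/ℕ a g g∣a = begin
  a                                                    ≡⟨ a≡a%ℕn+[a/ℕn]*n a (suc g) ⟩
  ℤ.+ (a ℤ.%ℕ suc g) ℤ.+ (a /ℕ suc g) ℤ.* ℤ.+ suc g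
    ≡⟨ cong (λ r → ℤ.+ r ℤ.+ (a /ℕ suc g) ℤ.* ℤ.+ suc g) (∣⇒%ℕ≡0 a g g∣a) ⟩
  ℤ.0ℤ ℤ.+ (a /ℕ suc g) ℤ.* ℤ.+ suc g                  ≡⟨ ℤ.+-identityˡ _ ⟩
  (a /ℕ suc g) ℤ.* ℤ.+ suc g                           ≡⟨ ℤ.*-comm (a /ℕ suc g) (ℤ.+ suc g) ⟩
  ℤ.+ suc g ℤ.* (a /ℕ suc g)                           ∎
  where open ≡-Reasoning

primitiveV-scale : ∀ {n} (v : Fin n → ℤ) → ∃ λ g → ∀ j → v j ≡ ℤ.+ suc g ℤ.* primitiveV v j
primitiveV-scale v with gcdV v | gcdV-∣ v
... | zero  | _   = 0 , λ j → sym (ℤ.*-identityˡ (v j))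
... | suc g | g∣v = g , λ j → ∣⇒≡*/ℕ (v j) g (g∣v j)

negIf-primitiveV-scale : ∀ {n} (negate : Bool) (v : Fin n → ℤ) →
  ∃ λ μ → μ ≢ ℤ.0ℤ × (∀ j → v j ≡ μ ℤ.* negIf negate (primitiveV v) j)
negIf-primitiveV-scale false v with primitiveV-scale v
... | g , v≡gw = ℤ.+ suc g , (λ ()) , v≡gw
negIf-primitiveV-scale true  v with primitiveV-scale v
... | g , v≡gw = ℤ.-[1+ g ] , (λ ()) , λ j → trans (v≡gw j) (neg*neg (ℤ.+ suc g) (primitiveV v j))
  where
  neg*neg : ∀ i w → i ℤ.* w ≡ ℤ.- i ℤ.* ℤ.- w
  neg*neg i w = begin
    i ℤ.* w                 ≡⟨ ℤ.neg-involutive _ ⟨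
    ℤ.- ℤ.- (i ℤ.* w)       ≡⟨ cong ℤ.-_ (ℤ.neg-distribʳ-* i w) ⟩
    ℤ.- (i ℤ.* ℤ.- w)       ≡⟨ ℤ.neg-distribˡ-* i (ℤ.- w) ⟩
    ℤ.- i ℤ.* ℤ.- w         ∎
    where open ≡-Reasoning

reduced-scale : ∀ {m n} (A : Mat ℤ m n) (b : Fin m → ℤ) (s : Fin m → Bool) i →
  ∃ λ μ → μ ≢ ℤ.0ℤ × (∀ j → A i j ≡ μ ℤ.* Abar A b s i j) × b i ≡ μ ℤ.* bbar A b s i
reduced-scale {n = n} A b s i with negIf-primitiveV-scale (s i) (augment A b i)
... | μ , μ≢0 , row≡μrow̄ =
  μ , μ≢0 , (λ j → trans (sym (snoc-inject₁ (A i) (b i) j)) (row≡μrow̄ (inject₁ j)))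
          , trans (sym (snoc-fromℕ (A i) (b i))) (row≡μrow̄ (fromℕ n))

module RowScaling {m n} (μ : Fin m → ℚ) {M M̄ : Mat ℚ m (suc n)} {c c̄ : Fin m → ℚ}
                  (M≡μM̄ : ∀ i j → M i j ≡ μ i * M̄ i j) (c≡μc̄ : ∀ i → c i ≡ μ i * c̄ i) where

  ·-scale : ∀ x i → (M · x) i ≡ μ i * (M̄ · x) i
  ·-scale x i = trans (sumF-cong (λ j → trans (cong (_* x j) (M≡μM̄ i j)) (*-assoc (μ i) (M̄ i j) (x j))))
                      (sumF-*ˡ (μ i) (λ j → M̄ i j * x j))

  residualAt-scale : ∀ x i → residualAt M c x i ≡ μ i * residualAt M̄ c̄ x i
  residualAt-scale x i = trans (cong₂ _-_ (·-scale x i) (c≡μc̄ i)) (distrib (μ i) ((M̄ · x) i) (c̄ i))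
    where
    distrib : ∀ m a b → m * a - m * b ≡ m * (a - b)
    distrib = solve-∀ ℚ-ring

  trivialKernel : TrivialKernel M → TrivialKernel M̄
  trivialKernel ker x M̄x≡0 = ker x (λ i → trans (·-scale x i) (trans (cong (μ i *_) (M̄x≡0 i)) (*-zeroʳ (μ i))))

  gram-det≢0 : det (M ᵀ ⊗ M) ≢ 0ℚ → det (M̄ ᵀ ⊗ M̄) ≢ 0ℚ
  gram-det≢0 det≢0 =
    anisotropic⇒det≢0 (M̄ ᵀ ⊗ M̄) (gram-anisotropic M̄ (trivialKernel (gram-det≢0⇒trivialKernel M det≢0)))

  -- Compare both residuals with M̄ y - c̄ for the least-squares solution y of (M, c);
  -- |μ i| ≥ 1 makes the rescaled vector shorter.
  lsResidual-≤ : (∀ i → 1ℚ ≤ μ i * μ i) → det (M ᵀ ⊗ M) ≢ 0ℚ →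
                 normSq (lsResidual M̄ c̄) ≤ normSq (lsResidual M c)
  lsResidual-≤ 1≤μ² det≢0 = begin
    normSq (lsResidual M̄ c̄)  ≤⟨ lsResidual-minimal M̄ c̄ (gram-det≢0 det≢0) y ⟩
    normSq ē                 ≤⟨ sumF-mono-≤ (λ i → square≤scaled (ē i) (1≤μ² i)) ⟩
    sumF (λ i → (μ i * μ i) * (ē i * ē i))
      ≡⟨ sumF-cong (λ i → trans (cong₂ _*_ (residualAt-scale y i) (residualAt-scale y i)) (square-* (μ i) (ē i))) ⟨
    normSq (residualAt M c y) ≡⟨ normSq-cong (lsResidual≡residualAt M c) ⟨
    normSq (lsResidual M c)  ∎
    where
    open ≤-Reasoning
    y = lsSolution M c
    ē = residualAt M̄ c̄ y
    square-* : ∀ a e → (a * e) * (a * e) ≡ (a * a) * (e * e)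
    square-* = solve-∀ ℚ-ring
    square≤scaled : ∀ e {a} → 1ℚ ≤ a → e * e ≤ a * (e * e)
    square≤scaled e {a} 1≤a = let instance _ = nonNegative (square-nonNeg e) in
      subst (_≤ a * (e * e)) (*-identityˡ (e * e)) (*-monoʳ-≤-nonNeg (e * e) 1≤a)

  lsResidual≡0 : det (M ᵀ ⊗ M) ≢ 0ℚ → normSq (lsResidual M̄ c̄) ≡ 0ℚ → normSq (lsResidual M c) ≡ 0ℚ
  lsResidual≡0 det≢0 r̄≡0 = ≤-antisym (begin
    normSq (lsResidual M c)    ≤⟨ lsResidual-minimal M c det≢0 ȳ ⟩
    normSq (residualAt M c ȳ)  ≡⟨ sumF-zero (λ i → cong₂ _*_ (e≡0 i) (e≡0 i)) ⟩
    0ℚ                         ∎) (normSq-nonNeg (lsResidual M c))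
    where
    open ≤-Reasoning
    ȳ = lsSolution M̄ c̄
    e≡0 : ∀ i → residualAt M c ȳ i ≡ 0ℚ
    e≡0 i = begin-equality
      residualAt M c ȳ i         ≡⟨ residualAt-scale ȳ i ⟩
      μ i * residualAt M̄ c̄ ȳ i  ≡⟨ cong (μ i *_) (lsResidual≡residualAt M̄ c̄ i) ⟨
      μ i * lsResidual M̄ c̄ i    ≡⟨ cong (μ i *_) (normSq≡0⇒≡0 (lsResidual M̄ c̄) r̄≡0 i) ⟩
      μ i * 0ℚ                   ≡⟨ *-zeroʳ (μ i) ⟩
      0ℚ                         ∎

bothZero⊎bothPositive : ∀ {a b} → 0ℚ ≤ b → b ≤ a → (b ≡ 0ℚ → a ≡ 0ℚ) →
                        (a ≡ 0ℚ × b ≡ 0ℚ) ⊎ (0ℚ < a × 0ℚ < b)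
bothZero⊎bothPositive {a} {b} 0≤b b≤a b≡0⇒a≡0 with a ≟ 0ℚ
... | yes a≡0 = inj₁ (a≡0 , ≤-antisym (subst (b ≤_) a≡0 b≤a) 0≤b)
... | no  a≢0 = inj₂ ( nonNeg∧≢0⇒pos (≤-trans 0≤b b≤a) a≢0
                     , nonNeg∧≢0⇒pos 0≤b (λ b≡0 → a≢0 (b≡0⇒a≡0 b≡0)))

proposition4p1 : (k : ℕ) (A : Mat ℤ (suc (suc k)) (suc k)) (b : Fin (suc (suc k)) → ℤ)
    → det ((toℚM A ᵀ) ⊗ toℚM A) ≢ 0ℚ
    → (s : Fin (suc (suc k)) → Bool)
    → (normSq (residual (Abar A b s) (bbar A b s)) ≤ normSq (residual A b))
      × ((normSq (residual A b) ≡ 0ℚ × normSq (residual (Abar A b s) (bbar A b s)) ≡ 0ℚ)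
         ⊎ (0ℚ < normSq (residual A b) × 0ℚ < normSq (residual (Abar A b s) (bbar A b s))))
proposition4p1 k A b det≢0 s =
  ‖r̄‖²≤‖r‖² , bothZero⊎bothPositive (normSq-nonNeg r̄) ‖r̄‖²≤‖r‖² (lsResidual≡0 det≢0)
  where
  r̄ = residual (Abar A b s) (bbar A b s)
  μ : Fin (suc (suc k)) → ℤ
  μ i = proj₁ (reduced-scale A b s i)
  μ≢0 : ∀ i → μ i ≢ ℤ.0ℤ
  μ≢0 i = proj₁ (proj₂ (reduced-scale A b s i))
  open RowScaling (λ i → μ i / 1)
    (λ i j → trans (cong (_/ 1) (proj₁ (proj₂ (proj₂ (reduced-scale A b s i))) j)) (/1-* (μ i) (Abar A b s i j)))
    (λ i → trans (cong (_/ 1) (proj₂ (proj₂ (proj₂ (reduced-scale A b s i))))) (/1-* (μ i) (bbar A b s i)))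
  ‖r̄‖²≤‖r‖² : normSq r̄ ≤ normSq (residual A b)
  ‖r̄‖²≤‖r‖² = lsResidual-≤ (λ i → 1≤square (μ i) (μ≢0 i)) det≢0
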